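{- Let $F$ be a disjunctive sum of Generalized Flowers and Stalks with exactly one more blue Generalized Flower than red Generalized Flowers. If Right has a winning move under misère play in $F$ (i.e. Right wins moving first), then every such winning move is a cut of an edge in the stem of a blue Generalized Flower.
   Context: Hackenbush: finite graph with blue, red or green edges and ground vertices; Left cuts blue or green edges, Right cuts red or green; components disconnected from the ground are discarded; under misère play the last player to move loses. A Stalk of height $n$ is a path of $n$ green edges with one endpoint on the ground. A Generalized Flower is a green path of $h\ge1$ edges (the stem) with bottom vertex the only ground vertex, together with a red–blue Hackenbush position (the Blossom) attached at the top vertex of the stem. Its blossom value is the normal-play value of the Blossom; it is blue if positive and red if negative. -}

module Defs where

open import Data.Nat using (ℕ; zero; suc; _<_; _≤_)
open import Data.Product using (Σ; _×_; _,_; ∃)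
open import Data.Sum using (_⊎_)
open import Data.List using (List; []; _∷_)
open import Data.List.Relation.Unary.Any using (_─_)
open import Data.List.Relation.Unary.All using (All)
open import Data.List.Membership.Propositional using (_∈_)
open import Relation.Nullary using (¬_)
open import Relation.Binary.PropositionalEquality using (_≡_)

data Player : Set where
  left right : Player

opp : Player → Player
opp left  = right
opp right = left

module Play (Pos : Set) (Move : Player → Pos → Pos → Set) where

  data NWinsFirst  (p : Player) : Pos → Set
  data NWinsSecond (p : Player) : Pos → Set

  data NWinsFirst p where
    move : ∀ {G G'} → Move p G G' → NWinsSecond p G' → NWinsFirst p G

  data NWinsSecond p where
    reply : ∀ {G} → (∀ {G'} → Move (opp p) G G' → NWinsFirst p G') →
            NWinsSecond p G

  data MWinsFirst  (p : Player) : Pos → Set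
  data MWinsSecond (p : Player) : Pos → Set

  data MWinsFirst p where
    stuck : ∀ {G} → (∀ G' → ¬ Move p G G') → MWinsFirst p G
    move  : ∀ {G G'} → Move p G G' → MWinsSecond p G' → MWinsFirst p G

  data MWinsSecond p where
    reply : ∀ {G} → (∃ λ G' → Move (opp p) G G') →
            (∀ {G'} → Move (opp p) G G' → MWinsFirst p G') →
            MWinsSecond p G

-- Red–blue Hackenbush positions (used as Blossoms).
-- Vertices are natural numbers; the vertex 0 is the unique ground vertex
-- (for a Blossom: the top vertex of the stem, through which the Blossom
-- is connected to the ground).  Edges are listed (multi-edges and loops
-- allowed).

data RB : Set where
  blue red : RB

BEdge : Set
BEdge = ℕ × ℕ × RB

Blossom : Set
Blossom = List BEdge

data Conn (es : Blossom) : ℕ → Set where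
  ground : Conn es 0
  step   : ∀ {u v c} → Conn es u → ((u , v , c) ∈ es ⊎ (v , u , c) ∈ es) →
           Conn es v

colourOf : Player → RB
colourOf left  = blue
colourOf right = red

-- Edges disconnected from the ground stay
-- in the list but can never be cut again (they are "discarded").
data BMove (p : Player) (B : Blossom) : Blossom → Set where
  cut : ∀ {u v} (q : (u , v , colourOf p) ∈ B) → (Conn B u ⊎ Conn B v) →
        BMove p B (B ─ q)

module BPlay = Play Blossom BMove

Positive : Blossom → Set
Positive B = BPlay.NWinsFirst left B × BPlay.NWinsSecond left B

Negative : Blossom → Set
Negative B = BPlay.NWinsFirst right B × BPlay.NWinsSecond right B

BlueBlossom = Positive
RedBlossom  = Negative

-- Components: Stalks and Generalized Flowers.
--   stalk h     : green path of h edges on the ground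
--   flower h B  : green stem of h edges, bottom on the ground, Blossom B
--                 attached at the top vertex.
-- Stem/stalk edges are numbered 0 .. h-1 from the ground upwards; cutting
-- edge j leaves a stalk of height j (everything above is discarded).

data Comp : Set where
  stalk  : ℕ → Comp
  flower : ℕ → Blossom → Comp

data CompMove (p : Player) : Comp → Comp → Set where
  stalkCut   : ∀ {h j} → j < h → CompMove p (stalk h) (stalk j)
  stemCut    : ∀ {h j B} → j < h → CompMove p (flower h B) (stalk j)
  blossomCut : ∀ {h B B'} → BMove p B B' → CompMove p (flower h B) (flower h B')

Pos : Set
Pos = List Comp

data Move (p : Player) : Pos → Pos → Set where
  here  : ∀ {c c' F} → CompMove p c c' → Move p (c ∷ F) (c' ∷ F)
  there : ∀ {c F F'} → Move p F F' → Move p (c ∷ F) (c ∷ F')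

module Game = Play Pos Move

data BlueStemCut {p : Player} : ∀ {F F'} → Move p F F' → Set where
  here  : ∀ {h j B F} (lt : j < h) → BlueBlossom B →
          BlueStemCut (here {c = flower h B} {F = F} (stemCut lt))
  there : ∀ {c F F'} {m : Move p F F'} → BlueStemCut m →
          BlueStemCut (there {c = c} m)

WellFormedComp : Comp → Set
WellFormedComp (stalk h)    = 1 ≤ h
WellFormedComp (flower h B) = 1 ≤ h

WellFormed : Pos → Set
WellFormed = All WellFormedComp

data BlueCount : Pos → ℕ → Set where
  []      : BlueCount [] 0
  blueF   : ∀ {h B F n} → BlueBlossom B → BlueCount F n →
            BlueCount (flower h B ∷ F) (suc n)
  otherF  : ∀ {h B F n} → ¬ BlueBlossom B → BlueCount F n →
            BlueCount (flower h B ∷ F) n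
  stalkC  : ∀ {h F n} → BlueCount F n → BlueCount (stalk h ∷ F) n

data RedCount : Pos → ℕ → Set where
  []      : RedCount [] 0
  redF    : ∀ {h B F n} → RedBlossom B → RedCount F n →
            RedCount (flower h B ∷ F) (suc n)
  otherF  : ∀ {h B F n} → ¬ RedBlossom B → RedCount F n →
            RedCount (flower h B ∷ F) n
  stalkC  : ∀ {h F n} → RedCount F n → RedCount (stalk h ∷ F) n

-- Classify the Flowers of a position: p "positive" ones (blue
-- blossom), "tame" ones (Left wins the blossom moving second, i.e. value
-- ≥ 0) and x "wild" ones (anything).  We show that Right, moving second,
-- loses whenever x < p.  Left first chops wild Flowers at the ground; once
-- none is left, she plays misère Nim on the stem/stalk heights, answers
-- every blossom move of Right inside the same blossom (a tame blossom
-- stays tame), and uses a positive blossom as a free "pass" if the Nim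
-- position is already lost for the player to move.  A Right move which is
-- not a stem cut of a blue Flower never lowers p, and never raises x, so if
-- it left a Right win we would have x < p afterwards — a contradiction.
-- Initially p = r + 1 and x ≤ r, because non-red blossoms are tame.

module Submission where

open import Defs
open import Data.Nat using (ℕ; zero; suc; _+_; _<_; _≤_; z≤n; s≤s; _≟_)
open import Data.Nat.Properties
  using (≤-refl; ≤-reflexive; ≤-trans; n<1+n; n≤1+n; ≤-pred; +-monoˡ-<; +-monoʳ-<)
open import Data.Unit using (⊤; tt)
open import Data.Empty using (⊥; ⊥-elim)
open import Data.Product using (Σ; _×_; _,_; ∃; proj₂)
open import Function using (id)
open import Data.Sum using (_⊎_; inj₁; inj₂) renaming (map to ⊎-map)
open import Data.List using (List; []; _∷_; length)
open import Data.List.Properties using (length-removeAt′)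
open import Data.List.Relation.Unary.All using (All) renaming ([] to []ᵃ; _∷_ to _∷ᵃ_)
open import Data.List.Relation.Unary.Any using (here; there; _─_)
open import Data.List.Membership.Propositional using (_∈_)
open import Relation.Nullary using (¬_; Dec; yes; no)
open import Relation.Nullary.Decidable using (_⊎-dec_; _×-dec_; map′)
open import Relation.Binary.PropositionalEquality using (_≡_; refl; sym; trans; cong; subst)

module _ {A : Set} where

  swap-removal : ∀ {x y : A} {xs} (p : x ∈ xs) (q : y ∈ xs) →
                 x ≡ y ⊎ Σ (x ∈ (xs ─ q)) λ p' → Σ (y ∈ (xs ─ p)) λ q' →
                             (xs ─ q ─ p') ≡ (xs ─ p ─ q')
  swap-removal (here px) (here qy) = inj₁ (trans px (sym qy))
  swap-removal (here px) (there q) = inj₂ (here px , q , refl)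
  swap-removal (there p) (here qy) = inj₂ (p , here qy , refl)
  swap-removal {xs = z ∷ _} (there p) (there q) with swap-removal p q
  ... | inj₁ same              = inj₁ same
  ... | inj₂ (p' , q' , comm) = inj₂ (there p' , there q' , cong (z ∷_) comm)

  reorder-removal : ∀ {x y : A} {xs} (q : y ∈ xs) (f : x ∈ (xs ─ q)) →
                    Σ (x ∈ xs) λ f' → Σ (y ∈ (xs ─ f')) λ q' → (xs ─ q ─ f) ≡ (xs ─ f' ─ q')
  reorder-removal (here qy) f         = there f , here qy , refl
  reorder-removal (there q) (here fx) = here fx , q , refl
  reorder-removal {xs = z ∷ _} (there q) (there f) with reorder-removal q f
  ... | f' , q' , comm = there f' , there q' , cong (z ∷_) comm

  from-removal : ∀ {x y : A} {xs} {q : y ∈ xs} → x ∈ (xs ─ q) → x ∈ xs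
  from-removal {q = here _}  f         = there f
  from-removal {q = there q} (here e)  = here e
  from-removal {q = there q} (there f) = there (from-removal f)

colour-≡ : ∀ {a b c a' b' c'} → _≡_ {A = BEdge} (a , b , c) (a' , b' , c') → c ≡ c'
colour-≡ refl = refl

colours-differ : ∀ p → colourOf p ≡ colourOf (opp p) → ⊥
colours-differ left  ()
colours-differ right ()

Adjacent : Blossom → ℕ → ℕ → RB → Set
Adjacent es u v c = (u , v , c) ∈ es ⊎ (v , u , c) ∈ es

Live : Blossom → ℕ → ℕ → Set
Live es a b = Conn es a ⊎ Conn es b

conn-shrink : ∀ {E x v} {q : x ∈ E} → Conn (E ─ q) v → Conn E v
conn-shrink ground     = ground
conn-shrink (step c e) = step (conn-shrink c) (⊎-map from-removal from-removal e)

-- After cutting (a, b, c), a formerly connected vertex is either still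
-- connected, or one endpoint of the cut edge still is (the ground path to
-- the vertex reached it through that endpoint).
conn-after-cut : ∀ {E a b c} (q : (a , b , c) ∈ E) {v} → Conn E v →
                 Conn (E ─ q) v ⊎ Live (E ─ q) a b
conn-after-cut q ground = inj₁ ground
conn-after-cut q (step cu e) with conn-after-cut q cu
... | inj₂ live = inj₂ live
conn-after-cut q (step cu (inj₁ m)) | inj₁ cu' with swap-removal m q
... | inj₁ refl           = inj₂ (inj₁ cu')
... | inj₂ (m' , _ , _) = inj₁ (step cu' (inj₁ m'))
conn-after-cut q (step cu (inj₂ m)) | inj₁ cu' with swap-removal m q
... | inj₁ refl           = inj₂ (inj₂ cu')
... | inj₂ (m' , _ , _) = inj₁ (step cu' (inj₂ m'))

live-after-cut : ∀ {E a b c} (q : (a , b , c) ∈ E) → Live E a b → Live (E ─ q) a b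
live-after-cut q (inj₁ ca) with conn-after-cut q ca
... | inj₁ ca'  = inj₁ ca'
... | inj₂ live = live
live-after-cut q (inj₂ cb) with conn-after-cut q cb
... | inj₁ cb'  = inj₂ cb'
... | inj₂ live = live

cut-separates : ∀ {E a b c} (q : (a , b , c) ∈ E) {v} →
                Conn E v → ¬ Conn (E ─ q) v → Live (E ─ q) a b
cut-separates q cv ncv with conn-after-cut q cv
... | inj₁ cv'  = ⊥-elim (ncv cv')
... | inj₂ live = live

cut-dead : ∀ {E a b c w} (d : (a , b , c) ∈ E) → ¬ Conn E a → ¬ Conn E b →
           Conn E w → Conn (E ─ d) w
cut-dead d na nb cw with conn-after-cut d cw
... | inj₁ cw'        = cw'
... | inj₂ (inj₁ ca) = ⊥-elim (na (conn-shrink ca))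
... | inj₂ (inj₂ cb) = ⊥-elim (nb (conn-shrink cb))

-- Paths from an arbitrary source; needed to decide connectivity by
-- induction on the edge list.
data Path (es : Blossom) (s : ℕ) : ℕ → Set where
  [] : Path es s s
  _▷_ : ∀ {u v c} → Path es s u → Adjacent es u v c → Path es s v

path-++ : ∀ {es s u v} → Path es s u → Path es u v → Path es s v
path-++ r []        = r
path-++ r (r' ▷ e) = path-++ r r' ▷ e

path-weaken : ∀ {e es s v} → Path es s v → Path (e ∷ es) s v
path-weaken []       = []
path-weaken (r ▷ a) = path-weaken r ▷ ⊎-map there there a

path-[] : ∀ {s v} → Path [] s v → s ≡ v
path-[] []              = refl
path-[] (_ ▷ inj₁ ())
path-[] (_ ▷ inj₂ ())

PathVia : Blossom → ℕ → ℕ → ℕ → ℕ → Set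
PathVia es a b s v = Path es s v ⊎ ((Path es s a × Path es b v) ⊎ (Path es s b × Path es a v))

path-∷⁻ : ∀ {a b c es s v} → Path ((a , b , c) ∷ es) s v → PathVia es a b s v
path-∷⁻ [] = inj₁ []
path-∷⁻ (r ▷ inj₁ (there m)) with path-∷⁻ r
... | inj₁ x              = inj₁ (x ▷ inj₁ m)
... | inj₂ (inj₁ (x , y)) = inj₂ (inj₁ (x , y ▷ inj₁ m))
... | inj₂ (inj₂ (x , y)) = inj₂ (inj₂ (x , y ▷ inj₁ m))
path-∷⁻ (r ▷ inj₂ (there m)) with path-∷⁻ r
... | inj₁ x              = inj₁ (x ▷ inj₂ m)
... | inj₂ (inj₁ (x , y)) = inj₂ (inj₁ (x , y ▷ inj₂ m))
... | inj₂ (inj₂ (x , y)) = inj₂ (inj₂ (x , y ▷ inj₂ m))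
path-∷⁻ (r ▷ inj₁ (here refl)) with path-∷⁻ r
... | inj₁ x              = inj₂ (inj₁ (x , []))
... | inj₂ (inj₁ (x , _)) = inj₂ (inj₁ (x , []))
... | inj₂ (inj₂ (x , _)) = inj₁ x
path-∷⁻ (r ▷ inj₂ (here refl)) with path-∷⁻ r
... | inj₁ x              = inj₂ (inj₂ (x , []))
... | inj₂ (inj₁ (x , _)) = inj₁ x
... | inj₂ (inj₂ (x , _)) = inj₂ (inj₂ (x , []))

path-∷⁺ : ∀ {a b c es s v} → PathVia es a b s v → Path ((a , b , c) ∷ es) s v
path-∷⁺ (inj₁ x)              = path-weaken x
path-∷⁺ (inj₂ (inj₁ (x , y))) = path-++ (path-weaken x ▷ inj₁ (here refl)) (path-weaken y)
path-∷⁺ (inj₂ (inj₂ (x , y))) = path-++ (path-weaken x ▷ inj₂ (here refl)) (path-weaken y)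

path? : ∀ es s v → Dec (Path es s v)
path? [] s v with s ≟ v
... | yes refl = yes []
... | no s≢v   = no (λ r → s≢v (path-[] r))
path? ((a , b , c) ∷ es) s v =
  map′ path-∷⁺ path-∷⁻
    (path? es s v ⊎-dec ((path? es s a ×-dec path? es b v) ⊎-dec (path? es s b ×-dec path? es a v)))

conn⇒path : ∀ {es v} → Conn es v → Path es 0 v
conn⇒path ground     = []
conn⇒path (step c e) = conn⇒path c ▷ e

path⇒conn : ∀ {es v} → Path es 0 v → Conn es v
path⇒conn []       = ground
path⇒conn (r ▷ e) = step (path⇒conn r) e

conn? : ∀ es v → Dec (Conn es v)
conn? es v = map′ path⇒conn conn⇒path (path? es 0 v)

open BPlay using (NWinsFirst; NWinsSecond; move; reply)

-- Cutting a dead edge d changes nothing: a win in X ─ d is a win in X.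
-- (Stated with an equation Y ≡ X ─ d so that the induction can proceed
-- along positions obtained by reordering removals.)
dead-edge-first  : ∀ {p X Y a b c} (d : (a , b , c) ∈ X) → ¬ Conn X a → ¬ Conn X b →
                   NWinsFirst p Y → Y ≡ (X ─ d) → NWinsFirst p X
dead-edge-second : ∀ {p X Y a b c} (d : (a , b , c) ∈ X) → ¬ Conn X a → ¬ Conn X b →
                   NWinsSecond p Y → Y ≡ (X ─ d) → NWinsSecond p X
dead-edge-first d na nb (move (cut e live) w) refl with reorder-removal d e
... | e' , d' , comm =
  move (cut e' (⊎-map conn-shrink conn-shrink live))
       (dead-edge-second d' (λ z → na (conn-shrink z)) (λ z → nb (conn-shrink z)) w comm)
dead-edge-second {p} {X} d na nb (reply answer) refl = reply answer'
  where
  answer' : ∀ {X'} → BMove (opp p) X X' → NWinsFirst p X'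
  answer' (cut e live) with swap-removal e d
  answer' (cut e (inj₁ ca)) | inj₁ refl = ⊥-elim (na ca)
  answer' (cut e (inj₂ cb)) | inj₁ refl = ⊥-elim (nb cb)
  answer' (cut e live)      | inj₂ (e' , d' , comm) =
    dead-edge-first d' (λ z → na (conn-shrink z)) (λ z → nb (conn-shrink z))
      (answer (cut e' (⊎-map (cut-dead d na nb) (cut-dead d na nb) live))) comm

opponent-cut-first  : ∀ {p E a b} (q : (a , b , colourOf (opp p)) ∈ E) →
                      NWinsFirst p E → NWinsFirst p (E ─ q)
opponent-cut-second : ∀ {p E a b} (q : (a , b , colourOf (opp p)) ∈ E) →
                      NWinsSecond p E → NWinsSecond p (E ─ q)
opponent-cut-second {p} {E} q (reply answer) = reply answer'
  where
  answer' : ∀ {X'} → BMove (opp p) (E ─ q) X' → NWinsFirst p X'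
  answer' (cut f live) with reorder-removal q f
  ... | f' , q' , comm =
    subst (NWinsFirst p) (sym comm)
      (opponent-cut-first q' (answer (cut f' (⊎-map conn-shrink conn-shrink live))))
-- p keeps her winning cut g; if g died together with q, then instead
-- Right's reply "cut q" in E ─ g shows that p wins after both cuts, and the
-- dead g may be ignored.
opponent-cut-first {p} {E} {a} {b} q (move (cut {u} {v} g live-g) w) with swap-removal g q
... | inj₁ same = ⊥-elim (colours-differ p (colour-≡ same))
... | inj₂ (g' , q' , comm) with conn? (E ─ q) u | conn? (E ─ q) v
... | yes cu | _      = move (cut g' (inj₁ cu)) (subst (NWinsSecond p) (sym comm) (opponent-cut-second q' w))
... | no _   | yes cv = move (cut g' (inj₂ cv)) (subst (NWinsSecond p) (sym comm) (opponent-cut-second q' w))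
... | no nu  | no nv  = dead-edge-first g' nu nv (after-q w) (sym comm)
  where
  -- an endpoint of g connected in E ─ g but not in E ─ q is reached
  -- through q, so q is still live in E ─ g
  through-q : ∀ {z} → ¬ Conn (E ─ q) z → Conn (E ─ g) z → Live (E ─ g) a b
  through-q nz cz =
    ⊎-map conn-shrink conn-shrink
      (cut-separates q' cz (λ c → nz (conn-shrink (subst (λ L → Conn L _) (sym comm) c))))

  q-live : Live (E ─ g) a b
  q-live with live-after-cut g live-g
  ... | inj₁ cu = through-q nu cu
  ... | inj₂ cv = through-q nv cv

  after-q : NWinsSecond p (E ─ g) → NWinsFirst p (E ─ g ─ q')
  after-q (reply answer) = answer (cut q' q-live)

left-right-exclusive₁ : ∀ {X} → NWinsFirst left X → NWinsSecond right X → ⊥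
left-right-exclusive₂ : ∀ {X} → NWinsFirst right X → NWinsSecond left X → ⊥
left-right-exclusive₁ (move m w) (reply answer) = left-right-exclusive₂ (answer m) w
left-right-exclusive₂ (move m w) (reply answer) = left-right-exclusive₁ (answer m) w

-- No blossom is a first-player win for both players (red–blue positions
-- are numbers): after Right's first cut, Left still wins moving first.
not-fuzzy : ∀ {B} → NWinsFirst left B → NWinsFirst right B → ⊥
not-fuzzy left-first (move (cut r _) right-second) =
  left-right-exclusive₁ (opponent-cut-first {left} r left-first) right-second

_≟ᶜ_ : (c d : RB) → Dec (c ≡ d)
blue ≟ᶜ blue = yes refl
blue ≟ᶜ red  = no (λ ())
red  ≟ᶜ blue = no (λ ())
red  ≟ᶜ red  = yes refl

all-or-some : ∀ {A : Set} (xs : List A) (P Q : ∀ {x} → x ∈ xs → Set) →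
              (∀ {x} (q : x ∈ xs) → P q ⊎ Q q) →
              (Σ A λ x → Σ (x ∈ xs) λ q → Q q) ⊎ (∀ {x} (q : x ∈ xs) → P q)
all-or-some []       P Q f = inj₂ (λ ())
all-or-some (y ∷ ys) P Q f with f (here refl)
... | inj₂ qy = inj₁ (y , here refl , qy)
... | inj₁ py with all-or-some ys (λ q → P (there q)) (λ q → Q (there q)) (λ q → f (there q))
...   | inj₁ (x , q , qx) = inj₁ (x , there q , qx)
...   | inj₂ all-p = inj₂ λ { (here refl) → py ; (there q) → all-p q }

moves-split : ∀ p X (A B : Blossom → Set) → (∀ {Y} → BMove p X Y → A Y ⊎ B Y) →
              (Σ Blossom λ Y → BMove p X Y × B Y) ⊎ (∀ {Y} → BMove p X Y → A Y)
moves-split p X A B f with all-or-some X Pm Qm classify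
  where
  Pm Qm : ∀ {x} → x ∈ X → Set
  Pm {x} q = ∀ {u v} → x ≡ (u , v , colourOf p) → Live X u v → A (X ─ q)
  Qm {x} q = Σ ℕ λ u → Σ ℕ λ v → x ≡ (u , v , colourOf p) × Live X u v × B (X ─ q)
  classify : ∀ {x} (q : x ∈ X) → Pm q ⊎ Qm q
  classify {u , v , c} q with c ≟ᶜ colourOf p
  ... | no c≢ = inj₁ (λ same _ → ⊥-elim (c≢ (colour-≡ same)))
  ... | yes refl with conn? X u ⊎-dec conn? X v
  ...   | no dead = inj₁ (λ { refl live → ⊥-elim (dead live) })
  ...   | yes live with f (cut q live)
  ...     | inj₁ a = inj₁ (λ _ _ → a)
  ...     | inj₂ b = inj₂ (u , v , refl , live , b)
... | inj₁ (_ , q , _ , _ , refl , live , b) = inj₁ (_ , cut q live , b)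
... | inj₂ all-a = inj₂ (λ { (cut q live) → all-a q refl live })

opp-involutive : ∀ p → opp (opp p) ≡ p
opp-involutive left  = refl
opp-involutive right = refl

normal-determined : ∀ n p X → length X < n → NWinsFirst p X ⊎ NWinsSecond (opp p) X
normal-determined (suc n) p X (s≤s bound)
  with moves-split p X (NWinsFirst (opp p)) (NWinsSecond p) after
  where
  after : ∀ {Y} → BMove p X Y → NWinsFirst (opp p) Y ⊎ NWinsSecond p Y
  after (cut q _) with normal-determined n (opp p) (X ─ q)
                         (≤-trans (≤-reflexive (sym (length-removeAt′ X _))) bound)
  ... | inj₁ w = inj₁ w
  ... | inj₂ w = inj₂ (subst (λ z → NWinsSecond z (X ─ q)) (opp-involutive p) w)
... | inj₁ (_ , m , w) = inj₁ (move m w)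
... | inj₂ all-lose   = inj₂ (reply (λ {Y} m → all-lose (subst (λ z → BMove z X Y) (opp-involutive p) m)))

left-wins-second-unless-red : ∀ {B} → ¬ RedBlossom B → NWinsSecond left B
left-wins-second-unless-red {B} not-red
  with normal-determined (suc (length B)) right B (n<1+n _)
... | inj₂ left-second = left-second
... | inj₁ right-first with normal-determined (suc (length B)) left B (n<1+n _)
...   | inj₂ right-second = ⊥-elim (not-red (right-first , right-second))
...   | inj₁ left-first   = ⊥-elim (not-fuzzy left-first right-first)

sum : List ℕ → ℕ
sum []       = 0
sum (h ∷ hs) = h + sum hs

data NimMove : List ℕ → List ℕ → Set where
  nh : ∀ {h j hs} → j < h → NimMove (h ∷ hs) (j ∷ hs)
  nt : ∀ {h hs hs'} → NimMove hs hs' → NimMove (h ∷ hs) (h ∷ hs')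

data NimN : List ℕ → Set
data NimP : List ℕ → Set
data NimN where
  stuckN : ∀ {hs} → (∀ {hs'} → ¬ NimMove hs hs') → NimN hs
  moveN  : ∀ {hs hs'} → NimMove hs hs' → NimP hs' → NimN hs
data NimP where
  replyP : ∀ {hs} → (∃ λ hs' → NimMove hs hs') →
           (∀ {hs'} → NimMove hs hs' → NimN hs') → NimP hs

below-split : ∀ h (A B : ℕ → Set) → (∀ {j} → j < h → A j ⊎ B j) →
              (Σ ℕ λ j → j < h × B j) ⊎ (∀ {j} → j < h → A j)
below-split zero    A B f = inj₂ (λ ())
below-split (suc h) A B f with f (s≤s z≤n)
... | inj₂ b = inj₁ (0 , s≤s z≤n , b)
... | inj₁ a with below-split h (λ j → A (suc j)) (λ j → B (suc j)) (λ lt → f (s≤s lt))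
...   | inj₁ (j , lt , b) = inj₁ (suc j , s≤s lt , b)
...   | inj₂ all-a = inj₂ λ { {zero} _ → a ; {suc j} (s≤s lt) → all-a lt }

nim-split : ∀ hs (A B : List ℕ → Set) → (∀ {hs'} → NimMove hs hs' → A hs' ⊎ B hs') →
            (Σ (List ℕ) λ hs' → NimMove hs hs' × B hs') ⊎ (∀ {hs'} → NimMove hs hs' → A hs')
nim-split []       A B f = inj₂ (λ ())
nim-split (h ∷ hs) A B f with below-split h (λ j → A (j ∷ hs)) (λ j → B (j ∷ hs)) (λ lt → f (nh lt))
... | inj₁ (j , lt , b) = inj₁ (j ∷ hs , nh lt , b)
... | inj₂ all-here with nim-split hs (λ z → A (h ∷ z)) (λ z → B (h ∷ z)) (λ m → f (nt m))
...   | inj₁ (hs' , m , b) = inj₁ (h ∷ hs' , nt m , b)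
...   | inj₂ all-there = inj₂ λ { (nh lt) → all-here lt ; (nt m) → all-there m }

sum-decreases : ∀ {hs hs'} → NimMove hs hs' → sum hs' < sum hs
sum-decreases {h ∷ hs} (nh lt) = +-monoˡ-< (sum hs) lt
sum-decreases {h ∷ hs} (nt m)  = +-monoʳ-< h (sum-decreases m)

nim-determined : ∀ n hs → sum hs < n → NimN hs ⊎ NimP hs
nim-determined (suc n) hs (s≤s bound)
  with nim-split hs NimN NimP (λ m → nim-determined n _ (≤-trans (sum-decreases m) bound))
... | inj₁ (_ , m , p) = inj₁ (moveN m p)
... | inj₂ all-n with nim-split hs (λ _ → ⊥) (λ _ → ⊤) (λ _ → inj₂ tt)
...   | inj₁ (hs' , m , _) = inj₂ (replyP (hs' , m) all-n)
...   | inj₂ no-move       = inj₁ (stuckN no-move)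

height : Comp → ℕ
height (stalk h)    = h
height (flower h _) = h

heights : Pos → List ℕ
heights []      = []
heights (c ∷ F) = height c ∷ heights F

Tame : Comp → Set
Tame (stalk _)    = ⊤
Tame (flower h B) = 1 ≤ h × NWinsSecond left B

follow-nim : ∀ p G {hs} → NimMove (heights G) hs →
             Σ Pos λ G' → Move p G G' × heights G' ≡ hs × (All Tame G → All Tame G')
follow-nim p (stalk _ ∷ F)    (nh lt) = _ , here (stalkCut lt) , refl , λ { (_ ∷ᵃ t) → tt ∷ᵃ t }
follow-nim p (flower _ _ ∷ F) (nh lt) = _ , here (stemCut lt) , refl , λ { (_ ∷ᵃ t) → tt ∷ᵃ t }
follow-nim p (c ∷ F) (nt m) with follow-nim p F m
... | G' , mv , eq , tame = c ∷ G' , there mv , cong (height c ∷_) eq , λ { (a ∷ᵃ t) → a ∷ᵃ tame t }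

nim-move-exists : ∀ {p G G'} → All Tame G → Move p G G' → ∃ λ hs → NimMove (heights G) hs
nim-move-exists _                    (here (stalkCut lt))   = _ , nh lt
nim-move-exists _                    (here (stemCut lt))    = _ , nh lt
nim-move-exists ((h≥1 , _) ∷ᵃ _)   (here (blossomCut _)) = _ , nh h≥1
nim-move-exists (_ ∷ᵃ t)            (there m) with nim-move-exists t m
... | _ , nm = _ , nt nm

right-move-shape : ∀ {G G'} → All Tame G → Move right G G' →
                   (NimMove (heights G) (heights G') × All Tame G') ⊎
                   (Σ Pos λ G'' → Move left G' G'' × heights G'' ≡ heights G × All Tame G'')
right-move-shape (_ ∷ᵃ t) (here (stalkCut lt)) = inj₁ (nh lt , tt ∷ᵃ t)
right-move-shape (_ ∷ᵃ t) (here (stemCut lt))  = inj₁ (nh lt , tt ∷ᵃ t)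
right-move-shape ((h≥1 , reply answer) ∷ᵃ t) (here (blossomCut bm)) with answer bm
... | move lm w = inj₂ (_ , here (blossomCut lm) , refl , (h≥1 , w) ∷ᵃ t)
right-move-shape {c ∷ _} (a ∷ᵃ t) (there m) with right-move-shape t m
... | inj₁ (nm , t')               = inj₁ (nt nm , a ∷ᵃ t')
... | inj₂ (G'' , lm , eq , t'') = inj₂ (c ∷ G'' , there lm , cong (height c ∷_) eq , a ∷ᵃ t'')

right-loses-tame : ∀ {G} → NimP (heights G) → All Tame G → Game.MWinsFirst right G → ⊥
right-loses-tame (replyP (_ , nm) _) tame (Game.stuck stuck) with follow-nim right _ nm
... | G' , mv , _ = stuck G' mv
right-loses-tame np@(replyP _ answer) tame (Game.move m (Game.reply left-can-move k))
  with right-move-shape tame m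
... | inj₂ (G'' , lm , eq , tame'') = right-loses-tame (subst NimP (sym eq) np) tame'' (k lm)
... | inj₁ (nm , tame') with answer nm
...   | stuckN none = none (proj₂ (nim-move-exists tame' (proj₂ left-can-move)))
...   | moveN nm' np' with follow-nim left _ nm'
...     | G'' , lm , eq , keep = right-loses-tame (subst NimP (sym eq) np') (keep tame') (k lm)

data Census : Pos → ℕ → ℕ → Set where
  []       : Census [] 0 0
  stalk    : ∀ {h F p x} → Census F p x → Census (stalk h ∷ F) p x
  positive : ∀ {h B F p x} → 1 ≤ h → Positive B → Census F p x → Census (flower h B ∷ F) (suc p) x
  tame     : ∀ {h B F p x} → 1 ≤ h → NWinsSecond left B → Census F p x → Census (flower h B ∷ F) p x
  wild     : ∀ {h B F p x} → 1 ≤ h → Census F p x → Census (flower h B ∷ F) p (suc x)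

census-tame : ∀ {G p} → Census G p 0 → All Tame G
census-tame []                        = []ᵃ
census-tame (stalk c)                 = tt ∷ᵃ census-tame c
census-tame (positive h≥1 (_ , s) c) = (h≥1 , s) ∷ᵃ census-tame c
census-tame (tame h≥1 s c)           = (h≥1 , s) ∷ᵃ census-tame c

cut-wild : ∀ {G p x} → Census G p (suc x) → Σ Pos λ G' → Move left G G' × Census G' p x
cut-wild (wild h≥1 c) = _ , here (stemCut h≥1) , stalk c
cut-wild (stalk c) with cut-wild c
... | _ , m , c' = _ , there m , stalk c'
cut-wild (positive h≥1 pos c) with cut-wild c
... | _ , m , c' = _ , there m , positive h≥1 pos c'
cut-wild (tame h≥1 s c) with cut-wild c
... | _ , m , c' = _ , there m , tame h≥1 s c'

-- Left "passes" by her winning move in a positive blossom, which leaves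
-- the heights unchanged and makes that blossom tame.
left-pass : ∀ {G p} → Census G (suc p) 0 →
            Σ Pos λ G' → Move left G G' × heights G' ≡ heights G × All Tame G'
left-pass (positive h≥1 (move lm w , _) c) = _ , here (blossomCut lm) , refl , (h≥1 , w) ∷ᵃ census-tame c
left-pass (stalk c) with left-pass c
... | _ , m , eq , t = _ , there m , cong (_ ∷_) eq , tt ∷ᵃ t
left-pass (tame h≥1 s c) with left-pass c
... | _ , m , eq , t = _ , there m , cong (_ ∷_) eq , (h≥1 , s) ∷ᵃ t

positive-nim-move : ∀ {G p x} → Census G (suc p) x → ∃ λ hs → NimMove (heights G) hs
positive-nim-move (positive h≥1 _ _) = _ , nh h≥1
positive-nim-move (stalk c)    with positive-nim-move c
... | _ , nm = _ , nt nm
positive-nim-move (tame _ _ c) with positive-nim-move c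
... | _ , nm = _ , nt nm
positive-nim-move (wild _ c)   with positive-nim-move c
... | _ , nm = _ , nt nm

record RightStep {G G' : Pos} (m : Move right G G') (p x : ℕ) : Set where
  constructor step
  field
    p' x'     : ℕ
    census'   : Census G' p' x'
    x'≤x      : x' ≤ x
    p≤1+p'    : p ≤ suc p'
    blue-stem : BlueStemCut m ⊎ p ≤ p'

harmless : ∀ {G G' p x} {m : Move right G G'} → Census G' p x → RightStep m p x
harmless c = step _ _ c ≤-refl (n≤1+n _) (inj₂ ≤-refl)

right-step : ∀ {G G' p x} → Census G p x → (m : Move right G G') → RightStep m p x
right-step (stalk c)          (here (stalkCut _)) = harmless (stalk c)
right-step (positive _ pos c) (here (stemCut lt)) = step _ _ (stalk c) ≤-refl ≤-refl (inj₁ (here lt pos))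
right-step (tame _ _ c)       (here (stemCut _))  = harmless (stalk c)
right-step (wild _ c)         (here (stemCut _))  = step _ _ (stalk c) (n≤1+n _) (n≤1+n _) (inj₂ ≤-refl)
right-step (positive h≥1 (_ , reply answer) c) (here (blossomCut bm@(cut q _))) =
  harmless (positive h≥1 (answer bm , opponent-cut-second q (reply answer)) c)
right-step (tame h≥1 s c) (here (blossomCut (cut q _))) = harmless (tame h≥1 (opponent-cut-second q s) c)
right-step (wild h≥1 c)   (here (blossomCut _))         = harmless (wild h≥1 c)
right-step (stalk c) (there m) with right-step c m
... | step p' x' c' x'≤x p≤1+p' b = step p' x' (stalk c') x'≤x p≤1+p' (⊎-map there id b)
right-step (positive h≥1 pos c) (there m) with right-step c m
... | step p' x' c' x'≤x p≤1+p' b = step (suc p') x' (positive h≥1 pos c') x'≤x (s≤s p≤1+p') (⊎-map there s≤s b)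
right-step (tame h≥1 s c) (there m) with right-step c m
... | step p' x' c' x'≤x p≤1+p' b = step p' x' (tame h≥1 s c') x'≤x p≤1+p' (⊎-map there id b)
right-step (wild h≥1 c) (there m) with right-step c m
... | step p' x' c' x'≤x p≤1+p' b = step p' (suc x') (wild h≥1 c') (s≤s x'≤x) p≤1+p' (⊎-map there id b)

right-loses-second : ∀ {G p x} → Census G p x → suc x ≤ p → Game.MWinsSecond right G → ⊥
right-loses-first  : ∀ {G p x} → Census G p x → suc (suc x) ≤ p → Game.MWinsFirst right G → ⊥
right-loses-second {x = suc x} c x<p (Game.reply _ k) with cut-wild c
... | _ , lm , c' = right-loses-first c' x<p (k lm)
right-loses-second {G} {suc p} {zero} c _ (Game.reply _ k)
  with nim-determined (suc (sum (heights G))) (heights G) (n<1+n _)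
... | inj₁ (stuckN none) = none (proj₂ (positive-nim-move c))
... | inj₁ (moveN nm np) with follow-nim left _ nm
...   | _ , lm , eq , keep = right-loses-tame (subst NimP (sym eq) np) (keep (census-tame c)) (k lm)
right-loses-second {G} {suc p} {zero} c _ (Game.reply _ k)
    | inj₂ np with left-pass c
...   | _ , lm , eq , t = right-loses-tame (subst NimP (sym eq) np) t (k lm)
right-loses-first c (s≤s (s≤s _)) (Game.stuck stuck) with follow-nim right _ (proj₂ (positive-nim-move c))
... | G' , mv , _ = stuck G' mv
right-loses-first c x+2≤p (Game.move m w) with right-step c m
... | step _ _ c' x'≤x p≤1+p' _ =
  right-loses-second c' (≤-pred (≤-trans (s≤s (s≤s x'≤x)) (≤-trans x+2≤p p≤1+p'))) w

-- Initially x ≤ r: a flower that is neither blue nor red is tame.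
initial-census : ∀ {F b r} → WellFormed F → BlueCount F b → RedCount F r →
                 Σ ℕ λ x → Census F b x × x ≤ r
initial-census []ᵃ [] [] = 0 , [] , z≤n
initial-census (h≥1 ∷ᵃ wf) (blueF pos bc) (redF _ rc) with initial-census wf bc rc
... | x , c , x≤r = x , positive h≥1 pos c , ≤-trans x≤r (n≤1+n _)
initial-census (h≥1 ∷ᵃ wf) (blueF pos bc) (otherF _ rc) with initial-census wf bc rc
... | x , c , x≤r = x , positive h≥1 pos c , x≤r
initial-census (h≥1 ∷ᵃ wf) (otherF _ bc) (redF _ rc) with initial-census wf bc rc
... | x , c , x≤r = suc x , wild h≥1 c , s≤s x≤r
initial-census (h≥1 ∷ᵃ wf) (otherF _ bc) (otherF not-red rc) with initial-census wf bc rc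
... | x , c , x≤r = x , tame h≥1 (left-wins-second-unless-red not-red) c , x≤r
initial-census (_ ∷ᵃ wf) (stalkC bc) (stalkC rc) with initial-census wf bc rc
... | x , c , x≤r = x , stalk c , x≤r

-- A winning Right move that is not a blue stem cut keeps p ≥ r + 1 > x,
-- so Right would lose moving second afterwards.
corollary4p7 : (F : Pos) → WellFormed F → (r : ℕ) →
    BlueCount F (suc r) → RedCount F r →
    (∃ λ F' → Move right F F' × Game.MWinsSecond right F') →
    ∀ {F'} (m : Move right F F') → Game.MWinsSecond right F' →
    BlueStemCut m
corollary4p7 F wf r bc rc _ m right-wins with initial-census wf bc rc
... | x , c , x≤r with right-step c m
...   | step _ _ _ _ _ (inj₁ blue-stem-cut) = blue-stem-cut
...   | step _ _ c' x'≤x _ (inj₂ r+1≤p') =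
        ⊥-elim (right-loses-second c' (≤-trans (s≤s (≤-trans x'≤x x≤r)) r+1≤p') right-wins)
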